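{- The problem Independent Set$_{\ell}$ has no solution-preserving DP-core of table-complexity $2^{o(k/\log k)}\cdot n^{O(1)}$ on $n$-vertex graphs of treewidth at most $k$.
   Context: Independent Set$_\ell$ is the vertex subset problem of all pairs $(G,X)$ with $X$ an independent set of size at least $\ell$ in $G$. A DP-core is a specification of a dynamic programming algorithm over nice edge-introducing tree decompositions, given by a finite set of leaf strings and functions IntroVertex, IntroEdge, ForgetVertex, Join (mapping strings to finite sets of strings) and a Final predicate; processing a decomposition bottom-up assigns to each node $u$ a set $\Gamma(u)$ of strings, and the decomposition is accepted iff the root set contains a final string. The DP-core solves $\Pi$ if it accepts a tree decomposition of $G$ iff $G$ has a solution. It has table complexity $\alpha(k,n)$ if $|\Gamma(u)|\le\alpha(k,n)$ for every node of every width-$\le k$ decomposition of every $n$-vertex graph. A witness tree assigns to each node a string consistent with the DP-core's operations and with a final string at the root. The DP-core is solution-preserving if there is a membership function $\mu:\mathbb{N}\times\{0,1\}^*\to\{0,1\}$ such that, extracting from a witness tree $W$ the set of vertices $v$ with $\mu(v,W(u_v))=1$ (where $u_v$ is the child of the node where $v$ is forgotten), every witness tree yields a solution, and every solution is obtained from some witness tree. -}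

module Defs where

open import Data.Nat using (ℕ; zero; suc; _+_; _*_; _^_; _≤_; _<_; _≟_)
open import Data.Nat.Logarithm using (⌊log₂_⌋)
open import Data.Bool using (Bool; true; false; if_then_else_)
open import Data.List using (List; []; _∷_; length; filter; _++_)
open import Data.List.Membership.Propositional using (_∈_; _∉_)
open import Data.List.Relation.Unary.All using (All)
open import Data.List.Relation.Unary.Unique.Propositional using (Unique)
open import Data.List.Relation.Binary.Permutation.Propositional using (_↭_)
open import Data.Product using (Σ; ∃; _×_; _,_; proj₁; proj₂)
open import Relation.Binary.PropositionalEquality using (_≡_)
open import Relation.Nullary using (¬_)
open import Relation.Nullary.Decidable using (¬?)

BitString : Set
BitString = List Bool

-- Finite simple graphs with vertices labelled by natural numbers.
-- An edge {u,v} is stored once, as the ordered pair (u , v) with u < v.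

record Graph : Set where
  field
    V        : List ℕ
    E        : List (ℕ × ℕ)
    V-unique : Unique V
    E-unique : Unique E
    E-ord    : All (λ e → proj₁ e < proj₂ e) E
    E-inV    : All (λ e → (proj₁ e ∈ V) × (proj₂ e ∈ V)) E
open Graph public

∣V∣ : Graph → ℕ
∣V∣ G = length (V G)

-- Nice edge-introducing tree decompositions, as terms

data TD : Set where
  leaf    : TD
  introV  : ℕ → TD → TD
  introE  : ℕ → ℕ → TD → TD
  forget  : ℕ → TD → TD
  join    : TD → TD → TD

remove : ℕ → List ℕ → List ℕ
remove v = filter (λ x → ¬? (x ≟ v))

bag : TD → List ℕ
bag leaf           = []
bag (introV v t)   = v ∷ bag t
bag (introE u v t) = bag t
bag (forget v t)   = remove v (bag t)
bag (join t₁ t₂)   = bag t₁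

forgotten : TD → List ℕ
forgotten leaf           = []
forgotten (introV v t)   = forgotten t
forgotten (introE u v t) = forgotten t
forgotten (forget v t)   = v ∷ forgotten t
forgotten (join t₁ t₂)   = forgotten t₁ ++ forgotten t₂

introduced : TD → List (ℕ × ℕ)
introduced leaf           = []
introduced (introV v t)   = introduced t
introduced (introE u v t) = (u , v) ∷ introduced t
introduced (forget v t)   = introduced t
introduced (join t₁ t₂)   = introduced t₁ ++ introduced t₂

data Valid (G : Graph) : TD → Set where
  leaf   : Valid G leaf
  introV : ∀ {v t} → Valid G t → v ∈ V G → v ∉ bag t → Valid G (introV v t)
  introE : ∀ {u v t} → Valid G t → u ∈ bag t → v ∈ bag t → (u , v) ∈ E G →
           Valid G (introE u v t)
  forget : ∀ {v t} → Valid G t → v ∈ bag t → Valid G (forget v t)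
  join   : ∀ {t₁ t₂} → Valid G t₁ → Valid G t₂ → bag t₁ ↭ bag t₂ →
           Valid G (join t₁ t₂)

-- t is a nice edge-introducing tree decomposition of G:
-- leaves and root have empty bags, every vertex is forgotten exactly once,
-- every edge is introduced exactly once.
IsTD : Graph → TD → Set
IsTD G t = Valid G t × (bag t ≡ []) × (forgotten t ↭ V G) × (introduced t ↭ E G)

data _⊑_ : TD → TD → Set where
  here   : ∀ {t} → t ⊑ t
  inV    : ∀ {u v t} → u ⊑ t → u ⊑ introV v t
  inE    : ∀ {u a b t} → u ⊑ t → u ⊑ introE a b t
  inF    : ∀ {u v t} → u ⊑ t → u ⊑ forget v t
  inJ₁   : ∀ {u t₁ t₂} → u ⊑ t₁ → u ⊑ join t₁ t₂
  inJ₂   : ∀ {u t₁ t₂} → u ⊑ t₂ → u ⊑ join t₁ t₂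

Width≤ : ℕ → TD → Set
Width≤ k t = ∀ u → u ⊑ t → length (bag u) ≤ suc k

record DPCore : Set where
  field
    Leaf         : List BitString
    IntroVertex  : ℕ → BitString → List BitString
    IntroEdge    : ℕ → ℕ → BitString → List BitString
    ForgetVertex : ℕ → BitString → List BitString
    Join         : BitString → BitString → List BitString
    Final        : BitString → Bool
open DPCore public

-- Reach C t s : s ∈ Γ(t), together with a witness subtree assigning
-- consistent strings to all nodes below t.
data Reach (C : DPCore) : TD → BitString → Set where
  leaf   : ∀ {s} → s ∈ Leaf C → Reach C leaf s
  introV : ∀ {v t s s'} → Reach C t s → s' ∈ IntroVertex C v s → Reach C (introV v t) s'
  introE : ∀ {u v t s s'} → Reach C t s → s' ∈ IntroEdge C u v s → Reach C (introE u v t) s'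
  forget : ∀ {v t s s'} → Reach C t s → s' ∈ ForgetVertex C v s → Reach C (forget v t) s'
  join   : ∀ {t₁ t₂ s₁ s₂ s'} → Reach C t₁ s₁ → Reach C t₂ s₂ → s' ∈ Join C s₁ s₂ →
           Reach C (join t₁ t₂) s'

Accepts : DPCore → TD → Set
Accepts C t = ∃ λ s → Reach C t s × (Final C s ≡ true)

Witness : DPCore → TD → Set
Witness C t = Σ BitString λ s → Reach C t s × (Final C s ≡ true)

-- extraction via a membership function μ : the vertices v with μ(v, W(u_v)) = 1,
-- u_v being the child of the node forgetting v
extract : ∀ {C t s} → (ℕ → BitString → Bool) → Reach C t s → List ℕ
extract μ (leaf _)        = []
extract μ (introV r _)    = extract μ r
extract μ (introE r _)    = extract μ r
extract μ (forget {v = v} {s = s} r _) =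
  if μ v s then v ∷ extract μ r else extract μ r
extract μ (join r₁ r₂ _)  = extract μ r₁ ++ extract μ r₂

extractW : ∀ {C t} → (ℕ → BitString → Bool) → Witness C t → List ℕ
extractW μ (_ , r , _) = extract μ r

Independent : Graph → List ℕ → Set
Independent G X = ∀ u v → u ∈ X → v ∈ X → (u , v) ∉ E G

IsSolution : ℕ → Graph → List ℕ → Set
IsSolution ℓ G X = Unique X × All (_∈ V G) X × Independent G X × (ℓ ≤ length X)

Solves : ℕ → DPCore → Set
Solves ℓ C = ∀ G t → IsTD G t →
  (Accepts C t → ∃ λ X → IsSolution ℓ G X) × ((∃ λ X → IsSolution ℓ G X) → Accepts C t)

SolutionPreserving : ℕ → DPCore → Set
SolutionPreserving ℓ C = ∃ λ (μ : ℕ → BitString → Bool) → ∀ G t → IsTD G t →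
  (∀ (w : Witness C t) → IsSolution ℓ G (extractW μ w)) ×
  (∀ X → IsSolution ℓ G X → ∃ λ (w : Witness C t) → extractW μ w ↭ X)

TableComplexity : DPCore → (ℕ → ℕ → ℕ) → Set
TableComplexity C α = ∀ k G t → IsTD G t → Width≤ k t → ∀ u → u ⊑ t →
  ∃ λ (L : List BitString) → (length L ≤ α k (∣V∣ G)) × (∀ s → Reach C u s → s ∈ L)

-- f ∈ o(k / log k):  for every ε = 1/(m+1) eventually f(k) ≤ ε · k / log₂ k
LittleO-k/logk : (ℕ → ℕ) → Set
LittleO-k/logk f = ∀ m → ∃ λ K → ∀ k → K ≤ k → f k * ⌊log₂ k ⌋ * suc m ≤ k

HasTableComplexity-2^o[k/logk]·poly : DPCore → Set
HasTableComplexity-2^o[k/logk]·poly C =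
  ∃ λ (f : ℕ → ℕ) → ∃ λ (c : ℕ) → LittleO-k/logk f ×
    TableComplexity C (λ k n → 2 ^ f k * suc n ^ c)

-- Take the perfect matching on the vertices 0, …, b-1 and b, …, 2b-1 with rungs {j, b+j}.
-- Its decomposition introduces the rungs one at a time, forgetting each upper endpoint
-- b+j at once, and finally forgets 0, …, b-1. The 2^b ways of picking one endpoint of
-- every rung are independent sets, so a solution-preserving DP-core has a witness tree
-- for each of them. If the table at the node just below the final forgets has fewer than
-- 2^b strings, two different choices S ≠ S′ meet in the same string there; grafting the
-- lower part of the witness for S′ under the upper part of the witness for S yields a
-- witness whose extracted set contains both endpoints of a rung where S and S′ differ,
-- which is not independent. For b = 2^j the bound 2^{f b} (2b+1)^c drops below 2^b.
module Submission where

open import Defs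
open import Data.Bool using (Bool; true; false; if_then_else_)
open import Data.Empty using (⊥; ⊥-elim)
open import Data.Fin as Fin using (Fin; remQuot; combine)
open import Data.Fin.Properties as Finₚ using (2↔Bool; combine-remQuot; pigeonhole)
open import Data.List using (List; []; _∷_; [_]; length; _++_; _ʳ++_; reverse; lookup; downFrom; applyDownFrom)
open import Data.List.Properties
  using (filter-all; filter-reject; length-filter; ++-assoc; length-++;
         length-downFrom; length-applyDownFrom; ʳ++-defn)
open import Data.List.Membership.Propositional using (_∈_; _∉_)
open import Data.List.Membership.Propositional.Properties
  using (∈-++⁺ˡ; ∈-++⁺ʳ; ∈-++⁻; ∈-applyDownFrom⁺; ∈-applyDownFrom⁻; ∈-downFrom⁺; ∈-downFrom⁻)
open import Data.List.Relation.Binary.Subset.Propositional using (_⊆_)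
open import Data.List.Relation.Binary.Permutation.Propositional using (_↭_; ↭-sym; ↭-trans; ↭-reflexive)
open import Data.List.Relation.Binary.Permutation.Propositional.Properties using (∈-resp-↭; ↭-reverse; ++⁺ʳ)
open import Data.List.Relation.Unary.All as All using (All; []; _∷_)
open import Data.List.Relation.Unary.All.Properties as Allₚ using (All¬⇒¬Any)
open import Data.List.Relation.Unary.Any using (here; there; index)
open import Data.List.Relation.Unary.Any.Properties using (lookup-index)
open import Data.List.Relation.Unary.Unique.Propositional using (Unique; _∷_)
import Data.List.Relation.Unary.Unique.Propositional.Properties as Uniqueₚ
open import Data.Nat
open import Data.Nat.Properties
open import Data.Nat.Logarithm using (⌊log₂_⌋; ⌊log₂[2^n]⌋≡n)
open import Data.Nat.Tactic.RingSolver using (solve-∀)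
open import Data.Product using (Σ; Σ-syntax; ∃; ∃-syntax; _×_; _,_; proj₁; proj₂)
open import Data.Sum using (inj₁; inj₂)
open import Function.Bundles using (Inverse)
open import Relation.Binary.PropositionalEquality using (_≡_; _≢_; refl; sym; trans; cong; cong₂; subst; module ≡-Reasoning)
open import Relation.Nullary using (¬_)
open import Relation.Nullary.Decidable using (¬?)

n<2^n : ∀ n → n < 2 ^ n
n<2^n zero    = z<s
n<2^n (suc n) = begin-strict
  suc n          ≤⟨ n<2^n n ⟩
  2 ^ n          <⟨ m<m+n (2 ^ n) (m^n>0 2 n) ⟩
  2 ^ n + 2 ^ n  ≡⟨ cong (2 ^ n +_) (sym (+-identityʳ (2 ^ n))) ⟩
  2 ^ suc n      ∎
  where open ≤-Reasoning

linear<2^[t+t] : ∀ c t → 4 + c * 4 ≤ t → (t + t + 2) * c * 2 < 2 ^ (t + t)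
linear<2^[t+t] c t 4+c*4≤t = begin-strict
  (t + t + 2) * c * 2  ≡⟨ expand c t ⟩
  c * 4 * t + c * 4    ≤⟨ +-monoʳ-≤ (c * 4 * t) (*-monoˡ-≤ 4 c≤t) ⟩
  c * 4 * t + t * 4    ≡⟨ collect c t ⟩
  (4 + c * 4) * t      ≤⟨ *-monoˡ-≤ t 4+c*4≤t ⟩
  t * t                <⟨ *-mono-< (n<2^n t) (n<2^n t) ⟩
  2 ^ t * 2 ^ t        ≡⟨ sym (^-distribˡ-+-* 2 t t) ⟩
  2 ^ (t + t)          ∎
  where
    open ≤-Reasoning
    c≤t : c ≤ t
    c≤t = ≤-trans (m≤m*n c 4) (≤-trans (m≤n+m (c * 4) 4) 4+c*4≤t)
    expand : ∀ c t → (t + t + 2) * c * 2 ≡ c * 4 * t + c * 4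
    expand = solve-∀
    collect : ∀ c t → c * 4 * t + t * 4 ≡ (4 + c * 4) * t
    collect = solve-∀

suc[2^j+2^j]≤2^[j+2] : ∀ j → suc (2 ^ j + 2 ^ j) ≤ 2 ^ (j + 2)
suc[2^j+2^j]≤2^[j+2] j = begin
  suc (b + b)          ≤⟨ +-monoˡ-≤ (b + b) (≤-trans (m^n>0 2 j) (m≤m+n b b)) ⟩
  b + b + (b + b)      ≡⟨ quadruple b ⟩
  b * 2 ^ 2            ≡⟨ sym (^-distribˡ-+-* 2 j 2) ⟩
  2 ^ (j + 2)          ∎
  where
    open ≤-Reasoning
    b = 2 ^ j
    quadruple : ∀ x → x + x + (x + x) ≡ x * 4
    quadruple = solve-∀

+-<-halves : ∀ {x y n} → x * 2 ≤ n → y * 2 < n → x + y < n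
+-<-halves {x} {y} {n} x*2≤n y*2<n = *-cancelʳ-< 2 (x + y) n (begin-strict
  (x + y) * 2    ≡⟨ *-distribʳ-+ 2 x y ⟩
  x * 2 + y * 2  <⟨ +-mono-≤-< x*2≤n y*2<n ⟩
  n + n          ≡⟨ cong (n +_) (sym (+-identityʳ n)) ⟩
  2 * n          ≡⟨ *-comm 2 n ⟩
  n * 2          ∎)
  where open ≤-Reasoning

-- Taking b = 2^j makes ⌊log₂ b⌋ = j exactly, so f b ≤ b / 2j.
2^f·poly<2^b : ∀ (f : ℕ → ℕ) c K ℓ → (∀ k → K ≤ k → f k * ⌊log₂ k ⌋ * 2 ≤ k) →
               ∃[ b ] ℓ ≤ b × 0 < b × 2 ^ f b * suc (b + b) ^ c < 2 ^ b
2^f·poly<2^b f c K ℓ f-small = b , ℓ≤b , m^n>0 2 j , (begin-strict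
  2 ^ f b * suc (b + b) ^ c    ≤⟨ *-monoʳ-≤ (2 ^ f b) (^-monoˡ-≤ c (suc[2^j+2^j]≤2^[j+2] j)) ⟩
  2 ^ f b * (2 ^ (j + 2)) ^ c  ≡⟨ cong (2 ^ f b *_) (^-*-assoc 2 (j + 2) c) ⟩
  2 ^ f b * 2 ^ ((j + 2) * c)  ≡⟨ sym (^-distribˡ-+-* 2 (f b) ((j + 2) * c)) ⟩
  2 ^ (f b + (j + 2) * c)      <⟨ ^-monoʳ-< 2 (s≤s (s≤s z≤n)) exponent<b ⟩
  2 ^ b                        ∎)
  where
    open ≤-Reasoning
    t = 4 + c * 4 + (K + ℓ)
    j = t + t
    b = 2 ^ j
    K+ℓ≤b : K + ℓ ≤ b
    K+ℓ≤b = ≤-trans (m≤n+m (K + ℓ) (4 + c * 4)) (≤-trans (m≤m+n t t) (<⇒≤ (n<2^n j)))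
    ℓ≤b : ℓ ≤ b
    ℓ≤b = ≤-trans (m≤n+m ℓ K) K+ℓ≤b
    fb*j*2≤b : f b * j * 2 ≤ b
    fb*j*2≤b = subst (λ x → f b * x * 2 ≤ b) (⌊log₂[2^n]⌋≡n j) (f-small b (≤-trans (m≤m+n K ℓ) K+ℓ≤b))
    exponent<b : f b + (j + 2) * c < b
    exponent<b = +-<-halves {f b} {(j + 2) * c} (≤-trans (*-monoˡ-≤ 2 (m≤m*n (f b) j)) fb*j*2≤b)
                                                      (linear<2^[t+t] c t (m≤m+n (4 + c * 4) (K + ℓ)))

bits : ∀ n → Fin (2 ^ n) → ℕ → Bool
bits zero    _ _       = false
bits (suc n) x zero    = Inverse.to 2↔Bool (proj₁ (remQuot {2} (2 ^ n) x))
bits (suc n) x (suc i) = bits n (proj₂ (remQuot {2} (2 ^ n) x)) i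

bits-injective : ∀ n {x y} → (∀ {i} → i < n → bits n x i ≡ bits n y i) → x ≡ y
bits-injective zero    {Fin.zero} {Fin.zero} _ = refl
bits-injective (suc n) {x} {y} same = begin
  x                                         ≡⟨ sym (combine-remQuot {2} (2 ^ n) x) ⟩
  combine (proj₁ (remQuot {2} (2 ^ n) x)) (proj₂ (remQuot {2} (2 ^ n) x))
    ≡⟨ cong₂ combine (to-injective (same z<s)) (bits-injective n (λ i<n → same (s<s i<n))) ⟩
  combine (proj₁ (remQuot {2} (2 ^ n) y)) (proj₂ (remQuot {2} (2 ^ n) y))
    ≡⟨ combine-remQuot {2} (2 ^ n) y ⟩
  y                                         ∎
  where
    open ≡-Reasoning
    open Inverse 2↔Bool using (to; from; strictlyInverseʳ)
    to-injective : ∀ {a a′} → to a ≡ to a′ → a ≡ a′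
    to-injective {a} {a′} eq = trans (sym (strictlyInverseʳ a)) (trans (cong from eq) (strictlyInverseʳ a′))

remove-head : ∀ v xs → remove v (v ∷ xs) ≡ remove v xs
remove-head v xs = filter-reject (λ x → ¬? (x ≟ v)) (λ v≢v → v≢v refl)

remove-∉ : ∀ {v xs} → v ∉ xs → remove v xs ≡ xs
remove-∉ {v} {xs} v∉xs =
  filter-all (λ x → ¬? (x ≟ v)) (All.tabulate λ x∈xs x≡v → v∉xs (subst (_∈ xs) x≡v x∈xs))

width-forget : ∀ {k v t} → Width≤ k t → Width≤ k (forget v t)
width-forget {v = v} {t} w _ here    = ≤-trans (length-filter (λ x → ¬? (x ≟ v)) (bag t)) (w t here)
width-forget             w u (inF p) = w u p

width-introE : ∀ {k a c t} → Width≤ k t → Width≤ k (introE a c t)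
width-introE {t = t} w _ here    = w t here
width-introE         w u (inE p) = w u p

width-introV : ∀ {k v t} → Width≤ k t → length (bag t) < suc k → Width≤ k (introV v t)
width-introV w l _ here    = l
width-introV w l u (inV p) = w u p

extract⊆forgotten : ∀ {C μ t s} (r : Reach C t s) → extract μ r ⊆ forgotten t
extract⊆forgotten (leaf _) ()
extract⊆forgotten (introV r _) = extract⊆forgotten r
extract⊆forgotten (introE r _) = extract⊆forgotten r
extract⊆forgotten {μ = μ} (forget {v = v} {s = s} r _) with μ v s
... | true  = λ { (here eq) → here eq ; (there p) → there (extract⊆forgotten r p) }
... | false = λ p → there (extract⊆forgotten r p)
extract⊆forgotten {μ = μ} (join {t₁ = t₁} r₁ r₂ _) p with ∈-++⁻ (extract μ r₁) p
... | inj₁ q = ∈-++⁺ˡ (extract⊆forgotten r₁ q)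
... | inj₂ q = ∈-++⁺ʳ (forgotten t₁) (extract⊆forgotten r₂ q)

-- Forgets the head of vs first, so forgetAll (bag t) t is the chain closing off t.
forgetAll : List ℕ → TD → TD
forgetAll []       t = t
forgetAll (v ∷ vs) t = forgetAll vs (forget v t)

forgotten-forgetAll : ∀ vs t → forgotten (forgetAll vs t) ≡ vs ʳ++ forgotten t
forgotten-forgetAll []       t = refl
forgotten-forgetAll (v ∷ vs) t = forgotten-forgetAll vs (forget v t)

introduced-forgetAll : ∀ vs t → introduced (forgetAll vs t) ≡ introduced t
introduced-forgetAll []       t = refl
introduced-forgetAll (v ∷ vs) t = introduced-forgetAll vs (forget v t)

⊑-forgetAll : ∀ {u} vs t → u ⊑ t → u ⊑ forgetAll vs t
⊑-forgetAll []       t p = p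
⊑-forgetAll (v ∷ vs) t p = ⊑-forgetAll vs (forget v t) (inF p)

width-forgetAll : ∀ {k} vs t → Width≤ k t → Width≤ k (forgetAll vs t)
width-forgetAll []       t w = w
width-forgetAll (v ∷ vs) t w = width-forgetAll vs (forget v t) (width-forget w)

forgetAll-bag : ∀ {G} vs t → Valid G t → bag t ≡ vs → Unique vs →
                Valid G (forgetAll vs t) × bag (forgetAll vs t) ≡ []
forgetAll-bag []       t valid bag≡ _                 = valid , bag≡
forgetAll-bag (v ∷ vs) t valid bag≡ (v≢vs ∷ vs-unique) =
  forgetAll-bag vs (forget v t) (forget valid (subst (v ∈_) (sym bag≡) (here refl))) bag-forget vs-unique
  where
    open ≡-Reasoning
    bag-forget : remove v (bag t) ≡ vs
    bag-forget = begin
      remove v (bag t)      ≡⟨ cong (remove v) bag≡ ⟩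
      remove v (v ∷ vs)     ≡⟨ remove-head v vs ⟩
      remove v vs           ≡⟨ remove-∉ (All¬⇒¬Any v≢vs) ⟩
      vs                    ∎

marked : Bool → ℕ → List ℕ
marked m v = if m then [ v ] else []

marked-++ : ∀ m v xs → (if m then v ∷ xs else xs) ≡ marked m v ++ xs
marked-++ true  v xs = refl
marked-++ false v xs = refl

marked⊆ : ∀ m v {vs} → All (_∈ v ∷ vs) (marked m v)
marked⊆ true  v = here refl ∷ []
marked⊆ false v = []

module _ (C : DPCore) (μ : ℕ → BitString → Bool) where

  -- A witness tree above a chain of forgets, cut at the bottom of the chain: the
  -- lower part can be replaced by any other one that reaches the same string.
  record Cut (vs : List ℕ) (t : TD) {s : BitString} (r : Reach C (forgetAll vs t) s) : Set where
    constructor mkCut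
    field
      mid         : BitString
      below       : Reach C t mid
      above       : List ℕ
      above⊆      : All (_∈ vs) above
      extract-cut : extract μ r ≡ above ++ extract μ below
      regraft     : (r′ : Reach C t mid) →
                    Σ[ r″ ∈ Reach C (forgetAll vs t) s ] extract μ r″ ≡ above ++ extract μ r′

  cut : ∀ vs t {s} (r : Reach C (forgetAll vs t) s) → Cut vs t r
  cut []       t r = mkCut _ r [] [] refl (λ r′ → r′ , refl)
  cut (v ∷ vs) t r with cut vs (forget v t) r
  ... | mkCut _ (forget {s = s₁} r₁ p) above above⊆ extract-cut regraft =
    mkCut s₁ r₁ (above ++ marked (μ v s₁) v)
      (Allₚ.++⁺ (All.map there above⊆) (marked⊆ (μ v s₁) v))
      (trans extract-cut (reassoc (extract μ r₁)))
      (λ r′ → proj₁ (regraft (forget r′ p)) , trans (proj₂ (regraft (forget r′ p))) (reassoc (extract μ r′)))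
    where
      reassoc : ∀ xs → above ++ (if μ v s₁ then v ∷ xs else xs) ≡ (above ++ marked (μ v s₁) v) ++ xs
      reassoc xs = trans (cong (above ++_) (marked-++ (μ v s₁) v xs)) (sym (++-assoc above _ xs))

module Matching (b : ℕ) (0<b : 0 < b) where

  upper : ℕ → ℕ
  upper j = b + j

  rung : ℕ → ℕ × ℕ
  rung j = j , upper j

  j<upper : ∀ j → j < upper j
  j<upper j = +-monoˡ-< j 0<b

  lower≢upper : ∀ {i} j → i < b → i ≢ upper j
  lower≢upper {i} j i<b refl = <⇒≱ i<b (m≤m+n b j)

  upper∉downFrom : ∀ {i n} → n ≤ upper i → upper i ∉ downFrom n
  upper∉downFrom n≤upper p = <⇒≱ (∈-downFrom⁻ p) n≤upper

  rungs : ℕ → TD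
  rungs zero    = leaf
  rungs (suc i) = forget (upper i) (introE i (upper i) (introV (upper i) (introV i (rungs i))))

  T : TD
  T = forgetAll (downFrom b) (rungs b)

  bag-rungs : ∀ i → bag (rungs i) ≡ downFrom i
  bag-rungs zero    = refl
  bag-rungs (suc i) = begin
    remove (upper i) (upper i ∷ i ∷ bag (rungs i))  ≡⟨ remove-head (upper i) _ ⟩
    remove (upper i) (i ∷ bag (rungs i))            ≡⟨ cong (λ xs → remove (upper i) (i ∷ xs)) (bag-rungs i) ⟩
    remove (upper i) (downFrom (suc i))             ≡⟨ remove-∉ (upper∉downFrom (j<upper i)) ⟩
    downFrom (suc i)                                ∎
    where open ≡-Reasoning

  forgotten-rungs : ∀ i → forgotten (rungs i) ≡ applyDownFrom upper i
  forgotten-rungs zero    = refl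
  forgotten-rungs (suc i) = cong (upper i ∷_) (forgotten-rungs i)

  introduced-rungs : ∀ i → introduced (rungs i) ≡ applyDownFrom rung i
  introduced-rungs zero    = refl
  introduced-rungs (suc i) = cong (rung i ∷_) (introduced-rungs i)

  lower∈V : ∀ {j} → j < b → j ∈ downFrom b ++ applyDownFrom upper b
  lower∈V j<b = ∈-++⁺ˡ (∈-downFrom⁺ j<b)

  upper∈V : ∀ {j} → j < b → upper j ∈ downFrom b ++ applyDownFrom upper b
  upper∈V j<b = ∈-++⁺ʳ (downFrom b) (∈-applyDownFrom⁺ upper j<b)

  G : Graph
  G = record
    { V        = downFrom b ++ applyDownFrom upper b
    ; E        = applyDownFrom rung b
    ; V-unique = Uniqueₚ.++⁺ (Uniqueₚ.downFrom⁺ b)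
                   (Uniqueₚ.applyDownFrom⁺₁ upper b (λ j<i _ eq → <⇒≢ j<i (sym (+-cancelˡ-≡ b _ _ eq))))
                   lower∩upper≡∅
    ; E-unique = Uniqueₚ.applyDownFrom⁺₁ rung b (λ j<i _ eq → <⇒≢ j<i (sym (cong proj₁ eq)))
    ; E-ord    = Allₚ.applyDownFrom⁺₁ rung b (λ _ → j<upper _)
    ; E-inV    = Allₚ.applyDownFrom⁺₁ rung b (λ j<b → lower∈V j<b , upper∈V j<b)
    }
    where
      lower∩upper≡∅ : ∀ {v} → ¬ (v ∈ downFrom b × v ∈ applyDownFrom upper b)
      lower∩upper≡∅ (p , q) with ∈-applyDownFrom⁻ upper q
      ... | j , _ , eq = lower≢upper j (∈-downFrom⁻ p) eq

  rung∈E : ∀ {j} → j < b → rung j ∈ E G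
  rung∈E = ∈-applyDownFrom⁺ rung

  valid-rungs : ∀ i → i ≤ b → Valid G (rungs i)
  valid-rungs zero    _   = leaf
  valid-rungs (suc i) i<b =
    forget (introE (introV (introV (valid-rungs i (<⇒≤ i<b)) (lower∈V i<b) i∉bag) (upper∈V i<b) upper∉bag)
                   (there (here refl)) (here refl) (rung∈E i<b))
           (here refl)
    where
      i∉bag : i ∉ bag (rungs i)
      i∉bag p = n≮n i (∈-downFrom⁻ (subst (i ∈_) (bag-rungs i) p))
      upper∉bag : upper i ∉ i ∷ bag (rungs i)
      upper∉bag p = upper∉downFrom (j<upper i) (subst (λ xs → upper i ∈ i ∷ xs) (bag-rungs i) p)

  length-bag-rungs : ∀ i → length (bag (rungs i)) ≡ i
  length-bag-rungs i = trans (cong length (bag-rungs i)) (length-downFrom i)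

  width-rungs : ∀ i → i ≤ b → Width≤ b (rungs i)
  width-rungs zero    _   _ here = z≤n
  width-rungs (suc i) i<b =
    width-forget (width-introE (width-introV (width-introV (width-rungs i (<⇒≤ i<b)) (m<n⇒m<1+n fits)) (s<s fits)))
    where
      fits : length (bag (rungs i)) < b
      fits = subst (_< b) (sym (length-bag-rungs i)) i<b

  T-isTD : IsTD G T
  T-isTD = proj₁ closed , proj₂ closed , forgotten↭V ,
           ↭-reflexive (trans (introduced-forgetAll (downFrom b) (rungs b)) (introduced-rungs b))
    where
      closed = forgetAll-bag (downFrom b) (rungs b) (valid-rungs b ≤-refl) (bag-rungs b) (Uniqueₚ.downFrom⁺ b)
      forgotten-T : forgotten T ≡ reverse (downFrom b) ++ applyDownFrom upper b
      forgotten-T = begin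
        forgotten T                                    ≡⟨ forgotten-forgetAll (downFrom b) (rungs b) ⟩
        downFrom b ʳ++ forgotten (rungs b)             ≡⟨ cong (downFrom b ʳ++_) (forgotten-rungs b) ⟩
        downFrom b ʳ++ applyDownFrom upper b           ≡⟨ ʳ++-defn (downFrom b) ⟩
        reverse (downFrom b) ++ applyDownFrom upper b  ∎
        where open ≡-Reasoning
      forgotten↭V : forgotten T ↭ V G
      forgotten↭V = ↭-trans (↭-reflexive forgotten-T) (++⁺ʳ (applyDownFrom upper b) (↭-reverse (downFrom b)))

  T-width : Width≤ b T
  T-width = width-forgetAll (downFrom b) (rungs b) (width-rungs b ≤-refl)

  ∣V∣≡b+b : ∣V∣ G ≡ b + b
  ∣V∣≡b+b = trans (length-++ (downFrom b)) (cong₂ _+_ (length-downFrom b) (length-applyDownFrom upper b))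

  choose : (ℕ → Bool) → ℕ → ℕ
  choose S j = if S j then j else upper j

  choice : (ℕ → Bool) → List ℕ
  choice S = applyDownFrom (choose S) b

  lower∈choice : ∀ S {j} → j < b → S j ≡ true → j ∈ choice S
  lower∈choice S {j} j<b Sj = subst (_∈ choice S) chosen (∈-applyDownFrom⁺ (choose S) j<b)
    where
      chosen : choose S j ≡ j
      chosen rewrite Sj = refl

  upper∈choice : ∀ S {j} → j < b → S j ≡ false → upper j ∈ choice S
  upper∈choice S {j} j<b Sj = subst (_∈ choice S) chosen (∈-applyDownFrom⁺ (choose S) j<b)
    where
      chosen : choose S j ≡ upper j
      chosen rewrite Sj = refl

  lower∈choice⁻ : ∀ S {j} → j < b → j ∈ choice S → S j ≡ true
  lower∈choice⁻ S {j} j<b p with ∈-applyDownFrom⁻ (choose S) p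
  ... | i , _ , eq with S i in Si
  ...   | true  = subst (λ x → S x ≡ true) (sym eq) Si
  ...   | false = ⊥-elim (lower≢upper i j<b eq)

  upper∈choice⁻ : ∀ S {j} → upper j ∈ choice S → S j ≡ false
  upper∈choice⁻ S {j} p with ∈-applyDownFrom⁻ (choose S) p
  ... | i , i<b , eq with S i in Si
  ...   | true  = ⊥-elim (lower≢upper j i<b (sym eq))
  ...   | false = subst (λ x → S x ≡ false) (+-cancelˡ-≡ b i j (sym eq)) Si

  choose-injective : ∀ S {i j} → i < b → j < b → choose S i ≡ choose S j → i ≡ j
  choose-injective S {i} {j} i<b j<b eq with S i | S j
  ... | true  | true  = eq
  ... | true  | false = ⊥-elim (lower≢upper j i<b eq)
  ... | false | true  = ⊥-elim (lower≢upper i j<b (sym eq))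
  ... | false | false = +-cancelˡ-≡ b i j eq

  choice-independent : ∀ S → Independent G (choice S)
  choice-independent S u v u∈ v∈ uv∈E with ∈-applyDownFrom⁻ rung uv∈E
  ... | j , j<b , refl with trans (sym (lower∈choice⁻ S j<b u∈)) (upper∈choice⁻ S v∈)
  ... | ()

  choice-unique : ∀ S → Unique (choice S)
  choice-unique S = Uniqueₚ.applyDownFrom⁺₁ (choose S) b
    (λ j<i i<b eq → <⇒≢ j<i (sym (choose-injective S i<b (<-trans j<i i<b) eq)))

  choice⊆V : ∀ S → All (_∈ V G) (choice S)
  choice⊆V S = Allₚ.applyDownFrom⁺₁ (choose S) b chosen∈V
    where
      chosen∈V : ∀ {j} → j < b → choose S j ∈ V G
      chosen∈V {j} j<b with S j
      ... | true  = lower∈V j<b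
      ... | false = upper∈V j<b

  choice-isSolution : ∀ {ℓ} S → ℓ ≤ b → IsSolution ℓ G (choice S)
  choice-isSolution {ℓ} S ℓ≤b =
    choice-unique S , choice⊆V S , choice-independent S ,
    subst (ℓ ≤_) (sym (length-applyDownFrom (choose S) b)) ℓ≤b

  module _ {ℓ C μ} (ℓ≤b : ℓ ≤ b)
           (sound : ∀ (w : Witness C T) → IsSolution ℓ G (extractW μ w))
           (complete : ∀ X → IsSolution ℓ G X → ∃ λ (w : Witness C T) → extractW μ w ↭ X)
           where

    exchange : ∀ {s₁ s₂} {r₁ : Reach C T s₁} {r₂ : Reach C T s₂} → Final C s₁ ≡ true →
               (c₁ : Cut C μ (downFrom b) (rungs b) r₁) (c₂ : Cut C μ (downFrom b) (rungs b) r₂) →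
               Cut.mid c₁ ≡ Cut.mid c₂ →
               ∀ {i} → i < b → i ∈ extract μ r₁ → upper i ∈ extract μ r₂ → ⊥
    exchange {s₁} final (mkCut _ below₁ above₁ _ split₁ regraft₁) (mkCut _ below₂ above₂ above₂⊆ split₂ _) refl
             {i} i<b i∈r₁ upper∈r₂ =
      independent i (upper i) i∈grafted upper∈grafted (rung∈E i<b)
      where
        grafted = regraft₁ below₂
        independent : Independent G (extract μ (proj₁ grafted))
        independent = proj₁ (proj₂ (proj₂ (sound (s₁ , proj₁ grafted , final))))
        i∈grafted : i ∈ extract μ (proj₁ grafted)
        i∈grafted with ∈-++⁻ above₁ (subst (i ∈_) split₁ i∈r₁)
        ... | inj₁ p = subst (i ∈_) (sym (proj₂ grafted)) (∈-++⁺ˡ p)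
        ... | inj₂ p with ∈-applyDownFrom⁻ upper (subst (i ∈_) (forgotten-rungs b) (extract⊆forgotten below₁ p))
        ...   | j , _ , eq = ⊥-elim (lower≢upper j i<b eq)
        upper∈grafted : upper i ∈ extract μ (proj₁ grafted)
        upper∈grafted with ∈-++⁻ above₂ (subst (upper i ∈_) split₂ upper∈r₂)
        ... | inj₁ p = ⊥-elim (upper∉downFrom (m≤m+n b i) (All.lookup above₂⊆ p))
        ... | inj₂ p = subst (upper i ∈_) (sym (proj₂ grafted)) (∈-++⁺ʳ above₁ p)

    choice-witness : ∀ x → ∃ λ (w : Witness C T) → extractW μ w ↭ choice (bits b x)
    choice-witness x = complete (choice (bits b x)) (choice-isSolution (bits b x) ℓ≤b)

    choice-reach : ∀ x → Reach C T (proj₁ (proj₁ (choice-witness x)))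
    choice-reach x = proj₁ (proj₂ (proj₁ (choice-witness x)))

    choice-final : ∀ x → Final C (proj₁ (proj₁ (choice-witness x))) ≡ true
    choice-final x = proj₂ (proj₂ (proj₁ (choice-witness x)))

    choice-cut : ∀ x → Cut C μ (downFrom b) (rungs b) (choice-reach x)
    choice-cut x = cut C μ (downFrom b) (rungs b) (choice-reach x)

    choice⊆extract : ∀ x → choice (bits b x) ⊆ extract μ (choice-reach x)
    choice⊆extract x = ∈-resp-↭ (↭-sym (proj₂ (choice-witness x)))

    same-mid⇒bit-true : ∀ x y → Cut.mid (choice-cut x) ≡ Cut.mid (choice-cut y) →
                        ∀ {i} → i < b → bits b x i ≡ true → bits b y i ≡ true
    same-mid⇒bit-true x y same {i} i<b x-true with bits b y i in y-bit
    ... | true  = refl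
    ... | false = ⊥-elim (exchange (choice-final x) (choice-cut x) (choice-cut y) same i<b
                                   (choice⊆extract x (lower∈choice _ i<b x-true))
                                   (choice⊆extract y (upper∈choice _ i<b y-bit)))

    same-mid⇒same-bits : ∀ x y → Cut.mid (choice-cut x) ≡ Cut.mid (choice-cut y) →
                         ∀ {i} → i < b → bits b x i ≡ bits b y i
    same-mid⇒same-bits x y same {i} i<b with bits b x i in x-bit | bits b y i in y-bit
    ... | true  | _     = trans (sym (same-mid⇒bit-true x y same i<b x-bit)) y-bit
    ... | false | true  = trans (sym x-bit) (same-mid⇒bit-true y x (sym same) i<b y-bit)
    ... | false | false = refl

    cut-table-size : (L : List BitString) → (∀ s → Reach C (rungs b) s → s ∈ L) → 2 ^ b ≤ length L
    cut-table-size L covers = ≮⇒≥ λ L<2^b →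
      let x , y , x<y , same-slot = pigeonhole L<2^b slot
      in Finₚ.<⇒≢ x<y (bits-injective b (same-mid⇒same-bits x y (same-mid same-slot)))
      where
        slot : Fin (2 ^ b) → Fin (length L)
        slot x = index (covers _ (Cut.below (choice-cut x)))
        same-mid : ∀ {x y} → slot x ≡ slot y → Cut.mid (choice-cut x) ≡ Cut.mid (choice-cut y)
        same-mid {x} {y} eq =
          trans (lookup-index (covers _ _)) (trans (cong (lookup L) eq) (sym (lookup-index (covers _ _))))

  cut-table-too-small : ∀ {ℓ C} → ℓ ≤ b → SolutionPreserving ℓ C →
                        ∀ α → TableComplexity C α → α b (b + b) < 2 ^ b → ⊥
  cut-table-too-small ℓ≤b (μ , preserving) α table α<2^b = <⇒≱ small-table large-table
    where
      cut-table = table b G T T-isTD T-width (rungs b) (⊑-forgetAll (downFrom b) (rungs b) here)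
      small-table : length (proj₁ cut-table) < 2 ^ b
      small-table = ≤-<-trans (proj₁ (proj₂ cut-table)) (subst (λ n → α b n < 2 ^ b) (sym ∣V∣≡b+b) α<2^b)
      large-table : 2 ^ b ≤ length (proj₁ cut-table)
      large-table = cut-table-size ℓ≤b (proj₁ (preserving G T T-isTD)) (proj₂ (preserving G T T-isTD))
                                   (proj₁ cut-table) (proj₂ (proj₂ cut-table))

theorem7p2 : ∀ (ℓ : ℕ) → ¬ (Σ DPCore λ C →
               Solves ℓ C × SolutionPreserving ℓ C × HasTableComplexity-2^o[k/logk]·poly C)
theorem7p2 ℓ (C , _ , preserving , f , c , f-small , table) =
  let K , f·log≤ = f-small 1
      b , ℓ≤b , 0<b , bound = 2^f·poly<2^b f c K ℓ f·log≤
  in Matching.cut-table-too-small b 0<b ℓ≤b preserving (λ k n → 2 ^ f k * suc n ^ c) table bound
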